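{- Let $A=(a_1,\ldots,a_k)$ be a Pinwheel Scheduling instance and let $X$ be a state from which there exists an infinite schedule that is valid for $A$ starting at $X$. Let $u_j=a_j-x_j-1$ be the urgencies and let $u_{(0)}\le u_{(1)}\le\cdots\le u_{(k-1)}$ be these urgencies sorted in ascending order, indexed from $0$. Then $u_{(i)}\ge i$ for all $i\in\{0,\ldots,k-1\}$.
   Context: A state is a vector $X=(x_1,\ldots,x_k)$ of nonnegative integers; it is valid for $A$ if $0\le x_j<a_j$ for all $j$. Executing an infinite schedule $s_1s_2\ldots$ (over $\{1,\ldots,k\}\cup\{ -\}$, "$-$" meaning no task) from $X(0)=X$ produces states $X(t)$ with $x_j(t)=0$ if $s_t=j$ and $x_j(t)=x_j(t-1)+1$ otherwise; the schedule is valid starting at $X$ if all $X(t)$, $t\ge0$, are valid. Equivalently, the urgency $u_j=a_j-x_j-1$ must stay nonnegative; it decreases by 1 each day and is reset to $a_j-1$ when task $j$ is executed. -}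

module Defs where

open import Data.Nat using (ℕ; zero; suc; _<_; _∸_)
open import Data.Nat.Properties using (≤-decTotalOrder)
open import Data.Fin using (Fin; _≟_)
open import Data.Maybe using (Maybe; just; nothing)
open import Data.List using (List; map)
open import Data.List.Base using (allFin)
open import Relation.Nullary using (yes; no)
import Data.List.Sort

Instance : ℕ → Set
Instance k = Fin k → ℕ

State : ℕ → Set
State k = Fin k → ℕ

ValidState : ∀ {k} → Instance k → State k → Set
ValidState A X = ∀ j → X j < A j

-- An infinite schedule s₁ s₂ …; (s t) is the entry s_{t+1};
-- nothing means "-" (no task).
Schedule : ℕ → Set
Schedule k = ℕ → Maybe (Fin k)

step : ∀ {k} → Maybe (Fin k) → State k → State k
step nothing  X j = suc (X j)
step (just i) X j with i ≟ j
... | yes _ = 0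
... | no  _ = suc (X j)

run : ∀ {k} → Schedule k → State k → ℕ → State k
run s X zero    = X
run s X (suc t) = step (s t) (run s X t)

ValidFrom : ∀ {k} → Instance k → Schedule k → State k → Set
ValidFrom A s X = ∀ t → ValidState A (run s X t)

-- Urgency u_j = a_j - x_j - 1 (a true natural number when X is valid).
urgency : ∀ {k} → Instance k → State k → Fin k → ℕ
urgency A X j = A j ∸ X j ∸ 1

open Data.List.Sort ≤-decTotalOrder using (sort)

sortedUrgencies : ∀ {k} → Instance k → State k → List ℕ
sortedUrgencies {k} A X = sort (map (urgency A X) (allFin k))

-- Task j must be executed on one of the first u_j + 1 days, otherwise x_j reaches a_j.
-- Distinct tasks are executed on distinct days, so at most c tasks have urgency below c.
-- If the i-th smallest urgency were below i, the i + 1 smallest urgencies would all be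
-- below i: one task too many.
module Submission where

open import Defs
open import Data.Nat using (ℕ; _≤_)
open import Data.Fin using (Fin; toℕ)
open import Data.List using (length; lookup)
open import Data.Product using (∃)

open import Data.Nat using (zero; suc; _+_; _∸_; _<_; _<?_; s≤s)
open import Data.Nat.Properties
import Data.Fin as Fin
import Data.Fin.Properties as Fin
open import Data.Maybe using (Maybe; just; nothing)
import Data.Maybe.Properties as Maybe
open import Data.List using (List; []; _∷_; map; filter; allFin)
open import Data.List.Properties using (length-map; filter-some; filter-accept)
open import Data.List.Relation.Unary.Any using (here)
import Data.List.Relation.Unary.All as All
open import Data.List.Relation.Unary.All using (All; _∷_)
open import Data.List.Relation.Unary.All.Properties using (all-filter)
open import Data.List.Relation.Unary.AllPairs using (AllPairs; _∷_)
open import Data.List.Relation.Unary.Linked.Properties using (Linked⇒AllPairs)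
open import Data.List.Relation.Unary.Unique.Propositional using (Unique)
import Data.List.Relation.Unary.Unique.Propositional.Properties as Unique
open import Data.List.Membership.Propositional.Properties using (∈-lookup)
open import Data.List.Relation.Binary.Permutation.Propositional.Properties using (filter-↭; ↭-length)
open import Data.Product using (_,_; _×_; proj₁; proj₂)
open import Data.Sum using (_⊎_; inj₁; inj₂)
open import Data.Empty using (⊥-elim)
open import Function using (_∘_)
open import Relation.Nullary using (yes; no)
open import Relation.Unary using (Pred; Decidable)
open import Relation.Binary.PropositionalEquality
open import Data.List.Sort ≤-decTotalOrder using (sort-↭; sort-↗)

module _ {A : Set} where

  lookup-injective : ∀ {xs : List A} → Unique xs →
                     ∀ {p q} → lookup xs p ≡ lookup xs q → p ≡ q
  lookup-injective {_ ∷ _}  _            {Fin.zero}  {Fin.zero}  _  = refl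
  lookup-injective {_ ∷ xs} (x∉xs ∷ _)   {Fin.zero}  {Fin.suc q} eq = ⊥-elim (All.lookup x∉xs (∈-lookup {xs = xs} q) eq)
  lookup-injective {_ ∷ xs} (x∉xs ∷ _)   {Fin.suc p} {Fin.zero}  eq = ⊥-elim (All.lookup x∉xs (∈-lookup {xs = xs} p) (sym eq))
  lookup-injective {_ ∷ _}  (_ ∷ unique) {Fin.suc p} {Fin.suc q} eq = cong Fin.suc (lookup-injective unique eq)

  filter-map : ∀ {B : Set} {p} {P : Pred B p} (P? : Decidable P) (f : A → B) xs →
               filter P? (map f xs) ≡ map f (filter (P? ∘ f) xs)
  filter-map P? f [] = refl
  filter-map P? f (x ∷ xs) with P? (f x)
  ... | yes _ = cong (f x ∷_) (filter-map P? f xs)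
  ... | no  _ = filter-map P? f xs

lookup<⇒toℕ<length-filter : ∀ {xs : List ℕ} → AllPairs _≤_ xs → ∀ i {c} →
                            lookup xs i < c → toℕ i < length (filter (_<? c) xs)
lookup<⇒toℕ<length-filter {x ∷ _} _ Fin.zero {c} x<c = filter-some (_<? c) (here x<c)
lookup<⇒toℕ<length-filter {x ∷ xs} (x≤xs ∷ xs↗) (Fin.suc i) {c} xᵢ<c
  = ≤-trans (s≤s (lookup<⇒toℕ<length-filter xs↗ i xᵢ<c)) (≤-reflexive (cong length (sym x∷xs-kept)))
  where
  x∷xs-kept : filter (_<? c) (x ∷ xs) ≡ x ∷ filter (_<? c) xs
  x∷xs-kept = filter-accept (_<? c) (≤-<-trans (All.lookup x≤xs (∈-lookup {xs = xs} i)) xᵢ<c)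

m+[1+[n∸m∸1]]≡n : ∀ {m n} → m < n → m + suc (n ∸ m ∸ 1) ≡ n
m+[1+[n∸m∸1]]≡n {zero}  {suc n} _         = refl
m+[1+[n∸m∸1]]≡n {suc m} {suc n} (s≤s m<n) = cong suc (m+[1+[n∸m∸1]]≡n m<n)

ExecutedBefore : ∀ {k} → Schedule k → ℕ → Fin k → Set
ExecutedBefore s n j = ∃ λ t → t < n × s t ≡ just j

module _ {k : ℕ} where

  step-≢ : ∀ {m : Maybe (Fin k)} (X : State k) {j} → m ≢ just j → step m X j ≡ suc (X j)
  step-≢ {nothing} X m≢j = refl
  step-≢ {just i}  X {j} m≢j with i Fin.≟ j
  ... | yes i≡j = ⊥-elim (m≢j (cong just i≡j))
  ... | no  _   = refl

  executedBefore⊎run≡+ : ∀ (s : Schedule k) X j n → ExecutedBefore s n j ⊎ run s X n j ≡ X j + n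
  executedBefore⊎run≡+ s X j zero = inj₂ (sym (+-identityʳ (X j)))
  executedBefore⊎run≡+ s X j (suc n) with executedBefore⊎run≡+ s X j n
  ... | inj₁ (t , t<n , sₜ≡j) = inj₁ (t , m<n⇒m<1+n t<n , sₜ≡j)
  ... | inj₂ idle with Maybe.≡-dec Fin._≟_ (s n) (just j)
  ...   | yes sₙ≡j = inj₁ (n , n<1+n n , sₙ≡j)
  ...   | no  sₙ≢j = inj₂ (begin
            step (s n) (run s X n) j ≡⟨ step-≢ (run s X n) sₙ≢j ⟩
            suc (run s X n j)        ≡⟨ cong suc idle ⟩
            suc (X j + n)            ≡⟨ +-suc (X j) n ⟨
            X j + suc n              ∎)
    where open ≡-Reasoning

  executedBefore-mono : ∀ {s : Schedule k} {m n j} → m ≤ n → ExecutedBefore s m j → ExecutedBefore s n j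
  executedBefore-mono m≤n (t , t<m , sₜ≡j) = t , <-≤-trans t<m m≤n , sₜ≡j

  validFrom⇒executedBefore : ∀ {A : Instance k} {s X} → ValidFrom A s X →
                             ∀ j → ExecutedBefore s (suc (urgency A X j)) j
  validFrom⇒executedBefore {A} {s} {X} valid j with executedBefore⊎run≡+ s X j (suc (urgency A X j))
  ... | inj₁ executed = executed
  ... | inj₂ idle     = ⊥-elim (n≮n (A j) (subst (_< A j) reaches-A (valid _ j)))
    where
    reaches-A : run s X (suc (urgency A X j)) j ≡ A j
    reaches-A = trans idle (m+[1+[n∸m∸1]]≡n (valid 0 j))

  length≤-executedBefore : ∀ (s : Schedule k) {n js} → Unique js → All (ExecutedBefore s n) js → length js ≤ n
  length≤-executedBefore s {n} {js} unique executed = Fin.injective⇒≤ day-injective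
    where
    executedAt : ∀ p → ExecutedBefore s n (lookup js p)
    executedAt p = All.lookup executed (∈-lookup p)

    day : Fin (length js) → Fin n
    day p = Fin.fromℕ< (proj₁ (proj₂ (executedAt p)))

    day-injective : ∀ {p q} → day p ≡ day q → p ≡ q
    day-injective {p} {q} eq with executedAt p | executedAt q | Fin.fromℕ<-injective _ _ _ _ eq
    ... | t , _ , sₜ≡p | .t , _ , sₜ≡q | refl = lookup-injective unique (Maybe.just-injective (trans (sym sₜ≡p) sₜ≡q))

urgentTasks : ∀ {k} → Instance k → State k → ℕ → List (Fin k)
urgentTasks {k} A X c = filter (λ j → urgency A X j <? c) (allFin k)

length-urgentTasks≤ : ∀ {k} {A : Instance k} {s X} → ValidFrom A s X →
                      ∀ c → length (urgentTasks A X c) ≤ c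
length-urgentTasks≤ {k} {A} {s} {X} valid c =
  length≤-executedBefore s (Unique.filter⁺ _ (Unique.allFin⁺ k))
    (All.map (λ {j} uⱼ<c → executedBefore-mono uⱼ<c (validFrom⇒executedBefore valid j))
             (all-filter _ (allFin k)))

sortedUrgencies-↗ : ∀ {k} (A : Instance k) X → AllPairs _≤_ (sortedUrgencies A X)
sortedUrgencies-↗ A X = Linked⇒AllPairs ≤-trans (sort-↗ _)

length-filter<-sortedUrgencies : ∀ {k} (A : Instance k) X c →
  length (filter (_<? c) (sortedUrgencies A X)) ≡ length (urgentTasks A X c)
length-filter<-sortedUrgencies {k} A X c = begin
  length (filter (_<? c) (sortedUrgencies A X))  ≡⟨ ↭-length (filter-↭ (_<? c) (sort-↭ urgencies)) ⟩
  length (filter (_<? c) urgencies)              ≡⟨ cong length (filter-map (_<? c) (urgency A X) (allFin k)) ⟩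
  length (map (urgency A X) (urgentTasks A X c)) ≡⟨ length-map (urgency A X) (urgentTasks A X c) ⟩
  length (urgentTasks A X c)                     ∎
  where
  open ≡-Reasoning
  urgencies : List ℕ
  urgencies = map (urgency A X) (allFin k)

proposition5 : ∀ {k} (A : Instance k) (X : State k)
    → ∃ (λ (s : Schedule k) → ValidFrom A s X)
    → (i : Fin (length (sortedUrgencies A X)))
    → toℕ i ≤ lookup (sortedUrgencies A X) i
proposition5 A X (s , valid) i = ≮⇒≥ λ uᵢ<i → n≮n (toℕ i) (begin-strict
  toℕ i                                               <⟨ lookup<⇒toℕ<length-filter (sortedUrgencies-↗ A X) i uᵢ<i ⟩
  length (filter (_<? toℕ i) (sortedUrgencies A X))  ≡⟨ length-filter<-sortedUrgencies A X (toℕ i) ⟩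
  length (urgentTasks A X (toℕ i))                    ≤⟨ length-urgentTasks≤ valid (toℕ i) ⟩
  toℕ i                                               ∎)
  where open ≤-Reasoning
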